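{- Let $\rho:d\to k^{\mathsf{u}}$ be a non-decreasing sort, $e:d_0\to d$ an increasing injection, $\mathcal{A}\in P(\rho)$ and $\mathcal{B}\in P(\rho\circ e)$. Then $\mathcal{A}|_{(e,\mathcal{B})}\in P(\rho)$.
   Context: Setting: finite relational language $\mathcal{L}=\{U_i:i<k^{\mathsf{u}}\}\cup\{R_i:i<k\}$ with conventions: each vertex satisfies exactly one $U_i$ ($U(a)=i$); $R_i(a,a)$ never; distinct $a,b$ satisfy exactly one $R_i(a,b)$ ($R(a,b)=i$); an involution $\mathrm{Flip}$ of $k$ fixing $0$ with $R_i(a,b)\iff R_{\mathrm{Flip}(i)}(b,a)$; $R=0$ means no relation. $\mathcal{F}$ a finite set of finite irreducible structures (irreducible: $R(a,b)\ne0$ for distinct $a,b$), $\mathcal{K}=\mathrm{Forb}(\mathcal{F})$. Standing assumption: every $i<k^{\mathsf{u}}$ is non-degenerate (some two-element structure in $\mathcal{K}$ has a vertex of unary $i$ and a nonzero relation). $\mathbf{K}$ is a fixed enumerated left-dense Fra\"iss\'e limit of $\mathcal{K}$ (underlying set $\omega$; $\mathbf{K}_n$ the induced structure on $\{0,\dots,n-1\}$; left dense: for every enumerated $\mathbf{B}\in\mathcal{K}$ with $|\mathbf{B}|=m+1$, $\mathbf{B}_m=\mathbf{K}_m$, there is an order-preserving embedding fixing $\{0,\dots,m-1\}$ with $R(f(m),r)=0$ for $m\le r<f(m)$). $T=k^{\mathsf{u}}\times k^{<\omega}$; $T(n)$, $\preceq_{lex}$ (unaries first, then lexicographic), coding map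 $c(n)\in T(n)$ with $c(n)^{\mathsf{u}}=U(n)$, $c(n)^{\mathsf{b}}(m)=R(n,m)$; $\mathrm{CT}(n)$ = restrictions to level $n$ of coding nodes. $\mathcal{L}_d$-structures: binary symbols plus unaries $V_0,\dots,V_{d-1}$ partitioning vertices ($V(b)=j$). For $S=\{s_0\prec_{lex}\dots\prec_{lex}s_{d-1}\}\subseteq T(n)$: $\mathbf{B}[S]$ is the $\mathcal{L}$-structure on $\{0,\dots,n-1\}\cup B$ equal to $\mathbf{K}_n$ there, binary part of $\mathbf{B}$ on $B$, $U(b)=s_{V(b)}^{\mathsf{u}}$, $R(b,x)=s_{V(b)}^{\mathsf{b}}(x)$; $\mathcal{K}(S)=\{\mathbf{B}:\mathbf{B}[S]\in\mathcal{K}\}$; $S^{\mathsf{u}}(j)=s_j^{\mathsf{u}}$; $P(\rho)=\{\mathcal{K}(S):S\subseteq\mathrm{CT}(n)\text{ for some }n,\ S^{\mathsf{u}}=\rho\}$. For an injection $e:d_0\to d$ and an $\mathcal{L}_d$-structure $\mathbf{B}$, $\mathbf{B}^e$ is the $\mathcal{L}_{d_0}$-structure on $\{b: V^{\mathbf{B}}(b)\in\mathrm{im}(e)\}$ with induced binary part and $V^{\mathbf{B}^e}(b)=e^{ -1}(V^{\mathbf{B}}(b))$. For a class $\mathcal{A}$ of $\mathcal{L}_d$-structures and a class $\mathcal{B}$ of $\mathcal{L}_{d_0}$-structures, $\mathcal{A}|_{(e,\mathcal{B})}=\{\mathbf{B}\in\mathcal{A}:\mathbf{B}^e\in\mathcal{B}\}$.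 -}

module Defs where

open import Data.Nat as ℕ using (ℕ; zero; suc; _+_)
open import Data.Fin as Fin using (Fin; zero; suc; toℕ; splitAt; inject₁; fromℕ)
open import Data.Fin.Properties using (_≟_)
open import Data.Vec using (Vec; []; _∷_; lookup; tabulate)
open import Data.List using (List; concatMap; map; filter; allFin; length)
open import Data.List.Relation.Unary.All using (All)
open import Data.Product using (Σ; ∃; _×_; _,_; proj₁; proj₂)
open import Data.Sum using (_⊎_; inj₁; inj₂)
open import Relation.Nullary using (¬_)
open import Relation.Binary.PropositionalEquality using (_≡_; _≢_)
open import Function.Bundles using (_↔_; Inverse)
open import Function.Definitions using (Injective)
import Data.List.Base as L

-- Language: unary symbols U_i (i < ku), binary symbols R_i (i < suc k);
-- R_0 = "no relation".  Flip is an involution on Fin (suc k) fixing 0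
-- (its properties are hypotheses of the theorem).

-- raw (possibly invalid) finite L-structure on {0,..,n-1}
record RawStr (ku k n : ℕ) : Set where
  field
    U : Fin n → Fin ku
    R : Fin n → Fin n → Fin (suc k)

record InfStr (ku k : ℕ) : Set where
  field
    U : ℕ → Fin ku
    R : ℕ → ℕ → Fin (suc k)

-- raw L_d-structure: binary part plus the partition V into d pieces
record LdRaw (k d m : ℕ) : Set where
  field
    R : Fin m → Fin m → Fin (suc k)
    V : Fin m → Fin d

LdStr : ℕ → ℕ → Set
LdStr k d = Σ ℕ (LdRaw k d)

LdClass : ℕ → ℕ → Set₁
LdClass k d = LdStr k d → Set

_≐_ : ∀ {k d} → LdClass k d → LdClass k d → Set
𝒜 ≐ ℬ = ∀ B → (𝒜 B → ℬ B) × (ℬ B → 𝒜 B)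

restrictV : ∀ {k d d₀} → (Fin d₀ → Fin d) → LdStr k d → LdStr k d₀
restrictV {k} {d} {d₀} e (m , B) = length Lst , record
  { R = λ x y → LdRaw.R B (proj₁ (L.lookup Lst x)) (proj₁ (L.lookup Lst y))
  ; V = λ x → proj₂ (L.lookup Lst x) }
  where
  Lst : List (Fin m × Fin d₀)
  Lst = concatMap (λ b → map (b ,_) (filter (λ i → e i ≟ LdRaw.V B b) (allFin d₀)))
                  (allFin m)

_∣[_,_] : ∀ {k d d₀} → LdClass k d → (Fin d₀ → Fin d) → LdClass k d₀ → LdClass k d
(𝒜 ∣[ e , ℬ ]) B = 𝒜 B × ℬ (restrictV e B)

-- The tree T = ku × k^{<ω}: nodes of level n

Node : ℕ → ℕ → ℕ → Set
Node ku k n = Fin ku × Vec (Fin (suc k)) n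

-- strict lexicographic order on vectors (position 0 most significant)
data _<lexV_ {A : ℕ} : {n : ℕ} → Vec (Fin A) n → Vec (Fin A) n → Set where
  here  : ∀ {n a b} {xs ys : Vec (Fin A) n} → a Fin.< b → (a ∷ xs) <lexV (b ∷ ys)
  there : ∀ {n a} {xs ys : Vec (Fin A) n} → xs <lexV ys → (a ∷ xs) <lexV (a ∷ ys)

_≺lex_ : ∀ {ku k n} → Node ku k n → Node ku k n → Set
(u , v) ≺lex (u' , v') = (u Fin.< u') ⊎ ((u ≡ u') × (v <lexV v'))

module Setting (ku k : ℕ) (Flip : Fin (suc k) → Fin (suc k))
               (𝓕 : List (Σ ℕ (RawStr ku k))) (𝐊 : InfStr ku k) where

  IsStr : ∀ {n} → RawStr ku k n → Set
  IsStr A = (∀ a → R a a ≡ zero) × (∀ a b → R b a ≡ Flip (R a b))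
    where open RawStr A

  IsIrreducible : ∀ {n} → RawStr ku k n → Set
  IsIrreducible A = ∀ a b → a ≢ b → RawStr.R A a b ≢ zero

  Emb : ∀ {m n} → RawStr ku k m → RawStr ku k n → Set
  Emb {m} {n} A B = Σ (Fin m → Fin n) λ f → Injective _≡_ _≡_ f
    × (∀ a → RawStr.U B (f a) ≡ RawStr.U A a)
    × (∀ a b → RawStr.R B (f a) (f b) ≡ RawStr.R A a b)

  InK : ∀ {n} → RawStr ku k n → Set
  InK A = IsStr A × All (λ F → ¬ Emb (proj₂ F) A) 𝓕

  open InfStr 𝐊 renaming (U to UK; R to RK)

  IsInfStr : Set
  IsInfStr = (∀ a → RK a a ≡ zero) × (∀ a b → RK b a ≡ Flip (RK a b))

  EmbK : ∀ {m} → RawStr ku k m → Set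
  EmbK {m} A = Σ (Fin m → ℕ) λ f → Injective _≡_ _≡_ f
    × (∀ a → UK (f a) ≡ RawStr.U A a)
    × (∀ a b → RK (f a) (f b) ≡ RawStr.R A a b)

  AgeIsK : Set
  AgeIsK = ∀ m (A : RawStr ku k m) → (InK A → EmbK A) × (EmbK A → InK A)

  Ultrahomogeneous : Set
  Ultrahomogeneous = ∀ m (f g : Fin m → ℕ) → Injective _≡_ _≡_ f → Injective _≡_ _≡_ g
    → (∀ a → UK (f a) ≡ UK (g a)) → (∀ a b → RK (f a) (f b) ≡ RK (g a) (g b))
    → Σ (ℕ ↔ ℕ) λ σ → let s = Inverse.to σ in
        (∀ x → UK (s x) ≡ UK x) × (∀ x y → RK (s x) (s y) ≡ RK x y)
        × (∀ a → s (f a) ≡ g a)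

  IsFraisseLimit : Set
  IsFraisseLimit = IsInfStr × AgeIsK × Ultrahomogeneous

  LeftDense : Set
  LeftDense = ∀ m (B : RawStr ku k (suc m)) → InK B
    → (∀ (i : Fin m) → RawStr.U B (inject₁ i) ≡ UK (toℕ i))
    → (∀ (i j : Fin m) → RawStr.R B (inject₁ i) (inject₁ j) ≡ RK (toℕ i) (toℕ j))
    → Σ (Fin (suc m) → ℕ) λ f →
        (∀ a b → a Fin.< b → f a ℕ.< f b)
        × (∀ a → UK (f a) ≡ RawStr.U B a)
        × (∀ a b → RK (f a) (f b) ≡ RawStr.R B a b)
        × (∀ (i : Fin m) → f (inject₁ i) ≡ toℕ i)
        × (∀ r → m ℕ.≤ r → r ℕ.< f (fromℕ m) → RK (f (fromℕ m)) r ≡ zero)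

  NonDegenerate : Set
  NonDegenerate = ∀ (i : Fin ku) → Σ (RawStr ku k 2) λ A → InK A
    × (Σ (Fin 2) λ a → RawStr.U A a ≡ i)
    × RawStr.R A zero (suc zero) ≢ zero

  -- coding node c(m) restricted to level n (for n ≤ m)
  codeRestr : (m n : ℕ) → Node ku k n
  codeRestr m n = UK m , tabulate (λ x → RK m (toℕ x))

  InCT : (n : ℕ) → Node ku k n → Set
  InCT n s = Σ ℕ λ m → (n ℕ.≤ m) × (s ≡ codeRestr m n)

  -- 𝐁[S] for S = {s 0 ≺ ... ≺ s (d-1)} ⊆ T(n); vertices: Fin n ⊎ B via splitAt
  plug : ∀ {n d} → (s : Fin d → Node ku k n) → (B : LdStr k d) → RawStr ku k (n + proj₁ B)
  plug {n} s (m , B) = record { U = U' ; R = R' }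
    where
    open LdRaw B
    U' : Fin (n + m) → Fin ku
    U' x with splitAt n x
    ... | inj₁ i = UK (toℕ i)
    ... | inj₂ b = proj₁ (s (V b))
    R' : Fin (n + m) → Fin (n + m) → Fin (suc k)
    R' x y with splitAt n x | splitAt n y
    ... | inj₁ i | inj₁ j = RK (toℕ i) (toℕ j)
    ... | inj₂ b | inj₂ b' = R b b'
    ... | inj₂ b | inj₁ j = lookup (proj₂ (s (V b))) j
    ... | inj₁ i | inj₂ b = Flip (lookup (proj₂ (s (V b))) i)

  𝒦[_] : ∀ {n d} → (Fin d → Node ku k n) → LdClass k d
  𝒦[ s ] B = InK (plug s B)

  P : ∀ {d} → (Fin d → Fin ku) → LdClass k d → Set
  P {d} ρ 𝒜 = Σ ℕ λ n → Σ (Fin d → Node ku k n) λ s →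
      (∀ i j → i Fin.< j → s i ≺lex s j)
    × (∀ j → InCT n (s j))
    × (∀ j → proj₁ (s j) ≡ ρ j)
    × (𝒜 ≐ 𝒦[ s ])

-- Let s ⊆ CT(n) and s' ⊆ CT(n') witness 𝒜 = 𝒦(s) and ℬ = 𝒦(s'). Ultrahomogeneity places in 𝐊 a
-- copy of 𝐊_{n'} above n with no relations to 𝐊_n; choose a level N above this copy. Let t_j ∈ T(N)
-- agree with s_j below n, with s'_{j'} on the copy when j = e(j'), and vanish elsewhere. A clique of
-- 𝐁[t] then lies in 𝐊_N, in 𝐊_n ∪ B or in the copy of 𝐊_{n'} together with the vertices of 𝐁ᵉ; the
-- latter two are images of 𝐁[s] and of 𝐁ᵉ[s'] respectively. Forbidden structures being irreducible, this
-- gives 𝒦(t) = 𝒦(s)|_(e, 𝒦(s')). Finally each one-vertex structure of colour j lies in 𝒦(t), and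
-- embedding it into 𝐊 over 𝐊_N produces a coding node through t_j; t inherits the order of s.

module Submission where

open import Defs
open import Data.Nat as ℕ using (ℕ; zero; suc; _+_)
import Data.Nat.Properties as ℕ
open import Data.Fin as Fin using (Fin; zero; suc; toℕ; splitAt; join; _↑ˡ_; _↑ʳ_; fromℕ<; _<_; _≤_)
open import Data.Fin.Properties
  using (_≟_; any?; <-cmp; toℕ-injective; toℕ<n; toℕ-fromℕ<; toℕ-↑ˡ; ↑ˡ-injective;
         splitAt-↑ˡ; splitAt-↑ʳ; splitAt-join; join-splitAt)
open import Data.Vec using (Vec; _∷_; lookup; tabulate)
open import Data.Vec.Properties using (lookup∘tabulate; tabulate∘lookup; tabulate-cong)
open import Data.List as List using (List; allFin; concatMap; filter)
open import Data.List.Extrema.Nat using (max; xs≤max)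
open import Data.List.Membership.Propositional using (_∈_)
open import Data.List.Membership.Propositional.Properties
  using (∈-concatMap⁺; ∈-concatMap⁻; ∈-map⁺; ∈-map⁻; ∈-filter⁺; ∈-filter⁻; ∈-allFin; ∈-lookup)
open import Data.List.Relation.Unary.All as All using (All)
import Data.List.Relation.Unary.Any as Any
open import Data.List.Relation.Unary.Any.Properties using (lookup-index)
open import Data.Product as Product using (Σ; _×_; _,_; proj₁; proj₂)
open import Data.Sum using (_⊎_; inj₁; inj₂; [_,_]′)
open import Data.Sum.Properties using (inj₁-injective; inj₂-injective; ≡-dec)
open import Data.Empty using (⊥; ⊥-elim)
open import Data.Unit using (⊤; tt)
open import Relation.Nullary using (¬_; Dec; yes; no)
open import Relation.Binary.PropositionalEquality
open import Relation.Binary.Definitions using (tri<; tri≈; tri>)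
open import Function using (_∘_)
open import Function.Definitions using (Injective)
open import Function.Bundles using (Inverse; Injection)
open import Function.Properties.Inverse using (↔⇒↣)

splitAt-injective : ∀ m {n} {x y : Fin (m + n)} → splitAt m x ≡ splitAt m y → x ≡ y
splitAt-injective m {n} {x} {y} eq =
  trans (sym (join-splitAt m n x)) (trans (cong (join m n) eq) (join-splitAt m n y))

increasing⇒injective : ∀ {d₀ d} {e : Fin d₀ → Fin d} → (∀ i j → i < j → e i < e j) → Injective _≡_ _≡_ e
increasing⇒injective {e = e} increasing {i} {j} eq with <-cmp i j
... | tri< i<j _ _ = ⊥-elim (ℕ.<-irrefl (cong toℕ eq) (increasing i j i<j))
... | tri≈ _ i≡j _ = i≡j
... | tri> _ _ j<i = ⊥-elim (ℕ.<-irrefl (cong toℕ (sym eq)) (increasing j i j<i))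

<lexV-extend : ∀ {a n l} {u u' : Vec (Fin a) n} {w w' : Vec (Fin a) (n + l)} → u <lexV u' →
  (∀ r → lookup w (r ↑ˡ l) ≡ lookup u r) → (∀ r → lookup w' (r ↑ˡ l) ≡ lookup u' r) → w <lexV w'
<lexV-extend {w = _ ∷ _} {_ ∷ _} (here lt) w≗u w'≗u' = here (subst₂ Fin._<_ (sym (w≗u zero)) (sym (w'≗u' zero)) lt)
<lexV-extend {w = x ∷ w} {x' ∷ w'} (there u<u') w≗u w'≗u' rewrite trans (w≗u zero) (sym (w'≗u' zero)) =
  there (<lexV-extend u<u' (w≗u ∘ suc) (w'≗u' ∘ suc))

bound-above : ∀ {n} (f : Fin n → ℕ) → Σ ℕ λ b → ∀ i → f i ℕ.< b
bound-above {n} f = suc (max 0 (List.map f (allFin n))) ,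
  λ i → ℕ.s≤s (All.lookup (xs≤max 0 _) (∈-map⁺ f (∈-allFin i)))

join-injective : ∀ m n → Injective _≡_ _≡_ (join m n)
join-injective m n {z} {z'} eq = trans (sym (splitAt-join m n z)) (trans (cong (splitAt m) eq) (splitAt-join m n z'))

IsInj₁ IsInj₂ : {A B : Set} → A ⊎ B → Set
IsInj₁ (inj₁ _) = ⊤
IsInj₁ (inj₂ _) = ⊥
IsInj₂ (inj₁ _) = ⊥
IsInj₂ (inj₂ _) = ⊤

inj₂≢inj₁ : {A B : Set} {a : A} {b : B} → inj₂ b ≢ inj₁ a
inj₂≢inj₁ ()

inj₂? : {A B : Set} (z : A ⊎ B) → Dec (Σ B λ b → z ≡ inj₂ b)
inj₂? (inj₁ _) = no λ { (_ , ()) }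
inj₂? (inj₂ b) = yes (b , refl)

¬inj₂⇒IsInj₁ : {A B : Set} (z : A ⊎ B) → ¬ (Σ B λ b → z ≡ inj₂ b) → IsInj₁ z
¬inj₂⇒IsInj₁ (inj₁ _) _ = tt
¬inj₂⇒IsInj₁ (inj₂ b) ¬inj₂ = ¬inj₂ (b , refl)

≐-trans : ∀ {k d} {𝒜 ℬ 𝒞 : LdClass k d} → 𝒜 ≐ ℬ → ℬ ≐ 𝒞 → 𝒜 ≐ 𝒞
≐-trans 𝒜≐ℬ ℬ≐𝒞 B = proj₁ (ℬ≐𝒞 B) ∘ proj₁ (𝒜≐ℬ B) , proj₂ (𝒜≐ℬ B) ∘ proj₂ (ℬ≐𝒞 B)

∣-cong : ∀ {k d d₀} {𝒜 𝒜' : LdClass k d} {ℬ ℬ' : LdClass k d₀} (e : Fin d₀ → Fin d) →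
  𝒜 ≐ 𝒜' → ℬ ≐ ℬ' → (𝒜 ∣[ e , ℬ ]) ≐ (𝒜' ∣[ e , ℬ' ])
∣-cong e 𝒜≐𝒜' ℬ≐ℬ' B = Product.map (proj₁ (𝒜≐𝒜' B)) (proj₁ (ℬ≐ℬ' (restrictV e B))) ,
                        Product.map (proj₂ (𝒜≐𝒜' B)) (proj₂ (ℬ≐ℬ' (restrictV e B)))

module _ {k d d₀ : ℕ} (e : Fin d₀ → Fin d) (B : LdStr k d) where
  private
    open LdRaw (proj₂ B)
    m = proj₁ B
    colourPairs : Fin m → List (Fin m × Fin d₀)
    colourPairs b = List.map (b ,_) (filter (λ j → e j ≟ V b) (allFin d₀))
    restrictedVertices : List (Fin m × Fin d₀)
    restrictedVertices = concatMap colourPairs (allFin m)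

  underlying : Fin (proj₁ (restrictV e B)) → Fin m
  underlying x = proj₁ (List.lookup restrictedVertices x)

  restrictV-colour : ∀ x → e (LdRaw.V (proj₂ (restrictV e B)) x) ≡ V (underlying x)
  restrictV-colour x
    with Any.satisfied (∈-concatMap⁻ colourPairs {xs = allFin m} (∈-lookup {xs = restrictedVertices} x))
  ... | b , mem with ∈-map⁻ (b ,_) mem
  ...   | j , mem' , refl = proj₂ (∈-filter⁻ (λ j → e j ≟ V b) {xs = allFin d₀} mem')

  restrictV-onto : ∀ b j → e j ≡ V b → Σ (Fin (proj₁ (restrictV e B))) λ x → underlying x ≡ b
  restrictV-onto b j ej≡Vb = Any.index mem , cong proj₁ (sym (lookup-index mem))
    where
    mem : (b , j) ∈ restrictedVertices
    mem = ∈-concatMap⁺ colourPairs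
            (Any.map (λ { refl → ∈-map⁺ (b ,_) (∈-filter⁺ (λ j → e j ≟ V b) (∈-allFin j) ej≡Vb) }) (∈-allFin b))

module _ (ku k : ℕ) (Flip : Fin (suc k) → Fin (suc k))
         (Flip-involutive : ∀ i → Flip (Flip i) ≡ i) (Flip-zero : Flip zero ≡ zero)
         (𝓕 : List (Σ ℕ (RawStr ku k))) (𝐊 : InfStr ku k) where
  open Setting ku k Flip 𝓕 𝐊
  open InfStr 𝐊 renaming (U to UK; R to RK)

  record Structure (X : Set) : Set where
    field
      U : X → Fin ku
      R : X → X → Fin (suc k)
  open Structure

  IsStructure : ∀ {X} → Structure X → Set
  IsStructure S = (∀ x → R S x x ≡ zero) × (∀ x y → R S y x ≡ Flip (R S x y))

  ⟦_⟧ : ∀ {n} → RawStr ku k n → Structure (Fin n)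
  ⟦ A ⟧ = record { U = RawStr.U A ; R = RawStr.R A }

  𝕂 : Structure ℕ
  𝕂 = record { U = UK ; R = RK }

  record _⟶_ {X Y : Set} (S : Structure X) (S' : Structure Y) : Set where
    field
      to : X → Y
      to-U : ∀ x → U S' (to x) ≡ U S x
      to-R : ∀ x y → R S' (to x) (to y) ≡ R S x y
      to-injective : ∀ x y → to x ≡ to y → x ≡ y ⊎ R S x y ≡ zero

  record _⇀_ {X Y : Set} (S : Structure X) (S' : Structure Y) : Set₁ where
    field
      Dom : X → Set
      map : ∀ x → Dom x → Y
      map-U : ∀ x p → U S' (map x p) ≡ U S x
      map-R : ∀ x y p q → R S' (map x p) (map y q) ≡ R S x y
      map-injective : ∀ x y p q → map x p ≡ map y q → x ≡ y ⊎ R S x y ≡ zero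

  open _⟶_
  open _⇀_

  private variable
    X Y Z : Set
    S₁ : Structure X
    S₂ : Structure Y
    S₃ : Structure Z

  _∘ₜ_ : S₂ ⟶ S₃ → S₁ ⟶ S₂ → S₁ ⟶ S₃
  (g ∘ₜ f) .to = to g ∘ to f
  (g ∘ₜ f) .to-U x = trans (to-U g (to f x)) (to-U f x)
  (g ∘ₜ f) .to-R x y = trans (to-R g (to f x) (to f y)) (to-R f x y)
  (g ∘ₜ f) .to-injective x y eq =
    [ to-injective f x y , inj₂ ∘ trans (sym (to-R f x y)) ]′ (to-injective g (to f x) (to f y) eq)

  _∘ₚ_ : S₂ ⇀ S₃ → S₁ ⇀ S₂ → S₁ ⇀ S₃
  (g ∘ₚ f) .Dom x = Σ (Dom f x) λ p → Dom g (map f x p)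
  (g ∘ₚ f) .map x (p , q) = map g (map f x p) q
  (g ∘ₚ f) .map-U x (p , q) = trans (map-U g _ q) (map-U f x p)
  (g ∘ₚ f) .map-R x y (p , q) (p' , q') = trans (map-R g _ _ q q') (map-R f x y p p')
  (g ∘ₚ f) .map-injective x y (p , q) (p' , q') eq =
    [ map-injective f x y p p' , inj₂ ∘ trans (sym (map-R f x y p p')) ]′ (map-injective g _ _ q q' eq)

  partial : S₁ ⟶ S₂ → S₁ ⇀ S₂
  partial f .Dom _ = ⊤
  partial f .map x _ = to f x
  partial f .map-U x _ = to-U f x
  partial f .map-R x y _ _ = to-R f x y
  partial f .map-injective x y _ _ = to-injective f x y

  inverse : S₁ ⟶ S₂ → S₂ ⇀ S₁
  inverse f .Dom y = Σ _ λ x → to f x ≡ y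
  inverse f .map _ = proj₁
  inverse f .map-U _ (x , refl) = sym (to-U f x)
  inverse f .map-R _ _ (x , refl) (x' , refl) = sym (to-R f x x')
  inverse f .map-injective _ _ (x , refl) (x' , refl) refl = inj₁ refl

  record IsClique {p} (S : Structure X) (h : Fin p → X) : Set where
    constructor isClique
    field related : ∀ x y → x ≢ y → R S (h x) (h y) ≢ zero

  clique-unrelated : ∀ {p} {h : Fin p → X} → IsClique S₁ h → ∀ x y → R S₁ (h x) (h y) ≡ zero → x ≡ y
  clique-unrelated clique x y unrelated with x ≟ y
  ... | yes x≡y = x≡y
  ... | no x≢y = ⊥-elim (IsClique.related clique x y x≢y unrelated)

  Covered : ∀ {p} → Structure X → (Fin p → X) → Set₁
  Covered S h = Σ (S ⇀ 𝕂) λ φ → ∀ x → Dom φ (h x)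

  CliquesEmbed : Structure X → Set₁
  CliquesEmbed {X} S = ∀ {p} (h : Fin p → X) → IsClique S h → Covered S h

  cliquesEmbed-⟶𝕂 : S₁ ⟶ 𝕂 → CliquesEmbed S₁
  cliquesEmbed-⟶𝕂 f h _ = partial f , λ _ → tt

  cliquesEmbed-pullback : S₁ ⟶ S₂ → CliquesEmbed S₂ → CliquesEmbed S₁
  cliquesEmbed-pullback f cliquesEmbed h clique = φ ∘ₚ partial f , λ x → tt , inDom x
    where
    φ-inDom = cliquesEmbed (to f ∘ h)
      (isClique λ x y x≢y → IsClique.related clique x y x≢y ∘ trans (sym (to-R f (h x) (h y))))
    φ = proj₁ φ-inDom
    inDom = proj₂ φ-inDom

  record IsSplitView {n m} (A : RawStr ku k (n + m)) (S : Structure (Fin n ⊎ Fin m)) : Set where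
    field
      U-split : ∀ x → RawStr.U A x ≡ U S (splitAt n x)
      R-split : ∀ x y → RawStr.R A x y ≡ R S (splitAt n x) (splitAt n y)
  open IsSplitView

  unsplit : ∀ {n m} → Structure (Fin n ⊎ Fin m) → RawStr ku k (n + m)
  unsplit {n} S = record { U = U S ∘ splitAt n ; R = λ x y → R S (splitAt n x) (splitAt n y) }

  unsplit-splitView : ∀ {n m} (S : Structure (Fin n ⊎ Fin m)) → IsSplitView (unsplit S) S
  unsplit-splitView S = record { U-split = λ _ → refl ; R-split = λ _ _ → refl }

  module _ {n m} {A : RawStr ku k (n + m)} {S : Structure (Fin n ⊎ Fin m)} (view : IsSplitView A S) where

    splitAt⟶ : ⟦ A ⟧ ⟶ S
    splitAt⟶ .to = splitAt n
    splitAt⟶ .to-U x = sym (U-split view x)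
    splitAt⟶ .to-R x y = sym (R-split view x y)
    splitAt⟶ .to-injective x y eq = inj₁ (splitAt-injective n eq)

    join⟶ : S ⟶ ⟦ A ⟧
    join⟶ .to = join n m
    join⟶ .to-U z = trans (U-split view _) (cong (U S) (splitAt-join n m z))
    join⟶ .to-R z z' = trans (R-split view _ _) (cong₂ (R S) (splitAt-join n m z) (splitAt-join n m z'))
    join⟶ .to-injective z z' eq = inj₁ (join-injective n m eq)

    isStr-splitView : IsStructure S → IsStr A
    isStr-splitView (S-irreflexive , S-flip) =
      (λ x → trans (R-split view x x) (S-irreflexive _)) ,
      (λ x y → trans (R-split view y x) (trans (S-flip _ _) (cong Flip (sym (R-split view x y)))))

  IsLdStr : ∀ {d} → LdStr k d → Set
  IsLdStr (_ , B) = (∀ b → RB b b ≡ zero) × (∀ b b' → RB b' b ≡ Flip (RB b b'))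
    where open LdRaw B renaming (R to RB)

  restrictV-isLdStr : ∀ {d d₀} (e : Fin d₀ → Fin d) {B : LdStr k d} → IsLdStr B → IsLdStr (restrictV e B)
  restrictV-isLdStr e (B-irreflexive , B-flip) = (λ x → B-irreflexive _) , (λ x y → B-flip _ _)

  module _ {n d} (s : Fin d → Node ku k n) (B : LdStr k d) where
    private
      open LdRaw (proj₂ B) renaming (R to RB)
      m = proj₁ B

    plug⊎ : Structure (Fin n ⊎ Fin m)
    plug⊎ .U (inj₁ r) = UK (toℕ r)
    plug⊎ .U (inj₂ b) = proj₁ (s (V b))
    plug⊎ .R (inj₁ r) (inj₁ r') = RK (toℕ r) (toℕ r')
    plug⊎ .R (inj₂ b) (inj₂ b') = RB b b'
    plug⊎ .R (inj₂ b) (inj₁ r) = lookup (proj₂ (s (V b))) r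
    plug⊎ .R (inj₁ r) (inj₂ b) = Flip (lookup (proj₂ (s (V b))) r)

    plug-splitView : IsSplitView (plug s B) plug⊎
    plug-splitView .U-split x with splitAt n x
    ... | inj₁ r = refl
    ... | inj₂ b = refl
    plug-splitView .R-split x y with splitAt n x | splitAt n y
    ... | inj₁ r | inj₁ r' = refl
    ... | inj₂ b | inj₂ b' = refl
    ... | inj₂ b | inj₁ r = refl
    ... | inj₁ r | inj₂ b = refl

    plug⊎-isStructure : IsInfStr → IsLdStr B → IsStructure plug⊎
    plug⊎-isStructure (K-irreflexive , K-flip) (B-irreflexive , B-flip) = irreflexive , flip
      where
      irreflexive : ∀ z → R plug⊎ z z ≡ zero
      irreflexive (inj₁ r) = K-irreflexive (toℕ r)
      irreflexive (inj₂ b) = B-irreflexive b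
      flip : ∀ z z' → R plug⊎ z' z ≡ Flip (R plug⊎ z z')
      flip (inj₁ r) (inj₁ r') = K-flip (toℕ r) (toℕ r')
      flip (inj₂ b) (inj₂ b') = B-flip b b'
      flip (inj₁ r) (inj₂ b) = sym (Flip-involutive _)
      flip (inj₂ b) (inj₁ r) = refl

    isLdStr-if-plug : IsStr (plug s B) → IsLdStr B
    isLdStr-if-plug (irreflexive , flip) =
      (λ b → trans (sym (R-at b b)) (irreflexive (n ↑ʳ b))) ,
      (λ b b' → trans (sym (R-at b' b)) (trans (flip (n ↑ʳ b) (n ↑ʳ b')) (cong Flip (R-at b b'))))
      where
      R-at : ∀ b b' → RawStr.R (plug s B) (n ↑ʳ b) (n ↑ʳ b') ≡ RB b b'
      R-at b b' = trans (R-split plug-splitView _ _) (cong₂ (R plug⊎) (splitAt-↑ʳ n m b) (splitAt-↑ʳ n m b'))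

    base⇀𝕂 : plug⊎ ⇀ 𝕂
    base⇀𝕂 .Dom = IsInj₁
    base⇀𝕂 .map (inj₁ r) _ = toℕ r
    base⇀𝕂 .map-U (inj₁ r) _ = refl
    base⇀𝕂 .map-R (inj₁ r) (inj₁ r') _ _ = refl
    base⇀𝕂 .map-injective (inj₁ r) (inj₁ r') _ _ eq = inj₁ (cong inj₁ (toℕ-injective eq))

  module _ (𝓕-irreducible : All (λ F → IsStr (proj₂ F) × IsIrreducible (proj₂ F)) 𝓕) (age : AgeIsK) where

    inK-if-cliquesEmbed : ∀ {n} (A : RawStr ku k n) → IsStr A → CliquesEmbed ⟦ A ⟧ → InK A
    inK-if-cliquesEmbed A A-isStr cliquesEmbed = A-isStr , All.tabulate noCopy
      where
      -- A copy h of F ∈ 𝓕 in A is a clique by irreducibility, so it embeds F into 𝐊,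
      -- putting F into Age(𝐊) = 𝒦 although F embeds into itself.
      noCopy : ∀ {F} → F ∈ 𝓕 → ¬ Emb (proj₂ F) A
      noCopy {p , F} F∈𝓕 (h , h-injective , h-U , h-R) = All.lookup (proj₂ F-inK) F∈𝓕 F↪F
        where
        h-clique : IsClique ⟦ A ⟧ h
        h-clique = isClique λ x y x≢y → proj₂ (All.lookup 𝓕-irreducible F∈𝓕) x y x≢y ∘ trans (sym (h-R x y))
        φ = proj₁ (cliquesEmbed h h-clique)
        inDom = proj₂ (cliquesEmbed h h-clique)
        ψ : Fin p → ℕ
        ψ x = map φ (h x) (inDom x)
        ψ-injective : Injective _≡_ _≡_ ψ
        ψ-injective {x} {y} eq with x ≟ y
        ... | yes x≡y = x≡y
        ... | no x≢y = [ h-injective , ⊥-elim ∘ IsClique.related h-clique x y x≢y ]′ (map-injective φ _ _ _ _ eq)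
        F-inK : InK F
        F-inK = proj₂ (age p F) (ψ , ψ-injective , (λ x → trans (map-U φ _ _) (h-U x)) ,
                                 (λ x y → trans (map-R φ _ _ _ _) (h-R x y)))
        F↪F : Emb F F
        F↪F = (λ x → x) , (λ eq → eq) , (λ _ → refl) , (λ _ _ → refl)

    inK⇒⟶𝕂 : ∀ {n} {A : RawStr ku k n} → InK A → ⟦ A ⟧ ⟶ 𝕂
    inK⇒⟶𝕂 {n} {A} A-inK = record
      { to = f ; to-U = f-U ; to-R = f-R ; to-injective = λ _ _ → inj₁ ∘ f-injective }
      where
      open Σ (proj₁ (age n A) A-inK) renaming (proj₁ to f; proj₂ to f-props)
      f-injective = proj₁ f-props
      f-U = proj₁ (proj₂ f-props)
      f-R = proj₂ (proj₂ f-props)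

    module _ {n m} {A : RawStr ku k (n + m)} {S : Structure (Fin n ⊎ Fin m)} (view : IsSplitView A S) where

      inK-splitView : IsStructure S → CliquesEmbed S → InK A
      inK-splitView S-isStructure cliquesEmbed =
        inK-if-cliquesEmbed A (isStr-splitView view S-isStructure) (cliquesEmbed-pullback (splitAt⟶ view) cliquesEmbed)

      splitView-⟶𝕂 : InK A → S ⟶ 𝕂
      splitView-⟶𝕂 A-inK = inK⇒⟶𝕂 A-inK ∘ₜ join⟶ view

  record EmbeddingOver {N} {Y : Set} (S : Structure (Fin N ⊎ Y)) : Set where
    field
      embed : Fin N ⊎ Y → ℕ
      embed-injective : Injective _≡_ _≡_ embed
      embed-U : ∀ z → UK (embed z) ≡ U S z
      embed-R : ∀ z z' → RK (embed z) (embed z') ≡ R S z z'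
      embed-fixes : ∀ r → embed (inj₁ r) ≡ toℕ r

    embed-above : ∀ y → N ℕ.≤ embed (inj₂ y)
    embed-above y with N ℕ.≤? embed (inj₂ y)
    ... | yes N≤ = N≤
    ... | no N≰ with embed-injective (trans (embed-fixes _) (toℕ-fromℕ< (ℕ.≰⇒> N≰)))
    ...   | ()

  module _ (age : AgeIsK) (ultrahomogeneous : Ultrahomogeneous) where

    embeddingOver : ∀ {N m} {A : RawStr ku k (N + m)} {S : Structure (Fin N ⊎ Fin m)} → IsSplitView A S → InK A →
      (∀ r → U S (inj₁ r) ≡ UK (toℕ r)) → (∀ r r' → R S (inj₁ r) (inj₁ r') ≡ RK (toℕ r) (toℕ r')) →
      EmbeddingOver S
    embeddingOver {N} {m} {A} {S} view A-inK S-U S-R = record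
      { embed = σ ∘ f ∘ join N m
      ; embed-injective = join-injective N m ∘ f-injective ∘ Injection.injective (↔⇒↣ σ↔)
      ; embed-U = λ z → trans (σ-U _) (trans (f-U _) (to-U (join⟶ view) z))
      ; embed-R = λ z z' → trans (σ-R _ _) (trans (f-R _ _) (to-R (join⟶ view) z z'))
      ; embed-fixes = σ-fixes }
      where
      open Σ (proj₁ (age (N + m) A) A-inK) renaming (proj₁ to f; proj₂ to f-props)
      f-injective = proj₁ f-props
      f-U = proj₁ (proj₂ f-props)
      f-R = proj₂ (proj₂ f-props)
      prefix-U : ∀ r → RawStr.U A (r ↑ˡ m) ≡ UK (toℕ r)
      prefix-U r = trans (U-split view _) (trans (cong (U S) (splitAt-↑ˡ N r m)) (S-U r))
      prefix-R : ∀ r r' → RawStr.R A (r ↑ˡ m) (r' ↑ˡ m) ≡ RK (toℕ r) (toℕ r')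
      prefix-R r r' = trans (R-split view _ _)
        (trans (cong₂ (R S) (splitAt-↑ˡ N r m) (splitAt-↑ˡ N r' m)) (S-R r r'))
      -- An automorphism of 𝐊 moves the image of the prefix back onto {0, …, N - 1}.
      moveBack = ultrahomogeneous N (f ∘ (_↑ˡ m)) toℕ (↑ˡ-injective m _ _ ∘ f-injective) toℕ-injective
                   (λ r → trans (f-U _) (prefix-U r)) (λ r r' → trans (f-R _ _) (prefix-R r r'))
      σ↔ = proj₁ moveBack
      σ = Inverse.to σ↔
      σ-U = proj₁ (proj₂ moveBack)
      σ-R = proj₁ (proj₂ (proj₂ moveBack))
      σ-fixes = proj₂ (proj₂ (proj₂ moveBack))

  amalgam⊎ : (n n' : ℕ) → Structure (Fin n ⊎ Fin n')
  amalgam⊎ n n' .U (inj₁ r) = UK (toℕ r)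
  amalgam⊎ n n' .U (inj₂ i) = UK (toℕ i)
  amalgam⊎ n n' .R (inj₁ r) (inj₁ r') = RK (toℕ r) (toℕ r')
  amalgam⊎ n n' .R (inj₂ i) (inj₂ i') = RK (toℕ i) (toℕ i')
  amalgam⊎ n n' .R (inj₁ _) (inj₂ _) = zero
  amalgam⊎ n n' .R (inj₂ _) (inj₁ _) = zero

  amalgam⊎-isStructure : IsInfStr → ∀ n n' → IsStructure (amalgam⊎ n n')
  amalgam⊎-isStructure (K-irreflexive , K-flip) n n' = irreflexive , flip
    where
    irreflexive : ∀ z → R (amalgam⊎ n n') z z ≡ zero
    irreflexive (inj₁ r) = K-irreflexive (toℕ r)
    irreflexive (inj₂ i) = K-irreflexive (toℕ i)
    flip : ∀ z z' → R (amalgam⊎ n n') z' z ≡ Flip (R (amalgam⊎ n n') z z')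
    flip (inj₁ r) (inj₁ r') = K-flip (toℕ r) (toℕ r')
    flip (inj₂ i) (inj₂ i') = K-flip (toℕ i) (toℕ i')
    flip (inj₁ _) (inj₂ _) = sym Flip-zero
    flip (inj₂ _) (inj₁ _) = sym Flip-zero

  amalgam⊎-cliquesEmbed : ∀ n n' → CliquesEmbed (amalgam⊎ n n')
  amalgam⊎-cliquesEmbed n n' h clique with any? (λ x → inj₂? (h x))
  ... | no noneRight = left , λ y → ¬inj₂⇒IsInj₁ (h y) λ right-y → noneRight (y , right-y)
    where
    left : amalgam⊎ n n' ⇀ 𝕂
    left .Dom = IsInj₁
    left .map (inj₁ r) _ = toℕ r
    left .map-U (inj₁ r) _ = refl
    left .map-R (inj₁ r) (inj₁ r') _ _ = refl
    left .map-injective (inj₁ r) (inj₁ r') _ _ eq = inj₁ (cong inj₁ (toℕ-injective eq))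
  ... | yes (x₀ , i₀ , hx₀) = right , sameSide
    where
    right : amalgam⊎ n n' ⇀ 𝕂
    right .Dom = IsInj₂
    right .map (inj₂ i) _ = toℕ i
    right .map-U (inj₂ i) _ = refl
    right .map-R (inj₂ i) (inj₂ i') _ _ = refl
    right .map-injective (inj₂ i) (inj₂ i') _ _ eq = inj₁ (cong inj₂ (toℕ-injective eq))
    sameSide : ∀ y → IsInj₂ (h y)
    sameSide y with h y in hy
    ... | inj₂ _ = tt
    ... | inj₁ r with clique-unrelated clique x₀ y (cong₂ (R (amalgam⊎ n n')) hx₀ hy)
    ...   | refl = inj₂≢inj₁ (trans (sym hx₀) hy)

  record DisjointCopy (n n' : ℕ) : Set where
    field
      copy : Fin n' → ℕ
      copy-injective : Injective _≡_ _≡_ copy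
      copy-above : ∀ i → n ℕ.≤ copy i
      copy-U : ∀ i → UK (copy i) ≡ UK (toℕ i)
      copy-R : ∀ i i' → RK (copy i) (copy i') ≡ RK (toℕ i) (toℕ i')
      copy-unrelated : ∀ i (r : Fin n) → RK (copy i) (toℕ r) ≡ zero

  Edgeless : ∀ {d} → LdStr k d → Set
  Edgeless (_ , B) = ∀ b b' → LdRaw.R B b b' ≡ zero

  edgeless-isLdStr : ∀ {d} {B : LdStr k d} → Edgeless B → IsLdStr B
  edgeless-isLdStr B-edgeless = (λ b → B-edgeless b b) ,
    (λ b b' → trans (B-edgeless b' b) (trans (sym Flip-zero) (cong Flip (sym (B-edgeless b b')))))

  point : ∀ {d} → Fin d → LdStr k d
  point j = 1 , record { R = λ _ _ → zero ; V = λ _ → j }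

  module _ (K-isStr : IsInfStr) (𝓕-irreducible : All (λ F → IsStr (proj₂ F) × IsIrreducible (proj₂ F)) 𝓕)
           (age : AgeIsK) where
    private
      K-irreflexive = proj₁ K-isStr
      K-flip = proj₂ K-isStr

    edgeless∈𝒦 : ∀ {n d} (s : Fin d → Node ku k n) → (∀ j → InCT n (s j)) → ∀ {B} → Edgeless B → 𝒦[ s ] B
    edgeless∈𝒦 {n} s s-CT {B} B-edgeless =
      inK-splitView 𝓕-irreducible age (plug-splitView s B)
        (plug⊎-isStructure s B K-isStr (edgeless-isLdStr {B = B} B-edgeless)) cliques
      where
      open LdRaw (proj₂ B) using (V)
      node : ∀ j → ℕ
      node j = proj₁ (s-CT j)
      node-lookup : ∀ j r → RK (node j) (toℕ r) ≡ lookup (proj₂ (s j)) r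
      node-lookup j r = sym (trans (cong (λ τ → lookup (proj₂ τ) r) (proj₂ (proj₂ (s-CT j)))) (lookup∘tabulate _ r))
      below-node : ∀ r j → toℕ r ≢ node j
      below-node r j eq = ℕ.<⇒≱ (toℕ<n r) (subst (n ℕ.≤_) (sym eq) (proj₁ (proj₂ (s-CT j))))
      vertex⇀𝕂 : Fin (proj₁ B) → plug⊎ s B ⇀ 𝕂
      vertex⇀𝕂 b₀ .Dom (inj₁ _) = ⊤
      vertex⇀𝕂 b₀ .Dom (inj₂ b) = b ≡ b₀
      vertex⇀𝕂 b₀ .map (inj₁ r) _ = toℕ r
      vertex⇀𝕂 b₀ .map (inj₂ b) _ = node (V b)
      vertex⇀𝕂 b₀ .map-U (inj₁ r) _ = refl
      vertex⇀𝕂 b₀ .map-U (inj₂ b) _ = cong proj₁ (sym (proj₂ (proj₂ (s-CT (V b)))))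
      vertex⇀𝕂 b₀ .map-R (inj₁ r) (inj₁ r') _ _ = refl
      vertex⇀𝕂 b₀ .map-R (inj₂ b) (inj₂ b') refl refl = trans (K-irreflexive _) (sym (B-edgeless b₀ b₀))
      vertex⇀𝕂 b₀ .map-R (inj₂ b) (inj₁ r) _ _ = node-lookup (V b) r
      vertex⇀𝕂 b₀ .map-R (inj₁ r) (inj₂ b) _ _ = trans (K-flip _ _) (cong Flip (node-lookup (V b) r))
      vertex⇀𝕂 b₀ .map-injective (inj₁ r) (inj₁ r') _ _ eq = inj₁ (cong inj₁ (toℕ-injective eq))
      vertex⇀𝕂 b₀ .map-injective (inj₂ b) (inj₂ b') refl refl _ = inj₁ refl
      vertex⇀𝕂 b₀ .map-injective (inj₁ r) (inj₂ b) _ _ eq = ⊥-elim (below-node r (V b) eq)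
      vertex⇀𝕂 b₀ .map-injective (inj₂ b) (inj₁ r) _ _ eq = ⊥-elim (below-node r (V b) (sym eq))
      -- An edgeless B meets a clique in at most one vertex.
      cliques : CliquesEmbed (plug⊎ s B)
      cliques h clique with any? (λ x → inj₂? (h x))
      ... | no noVertex = base⇀𝕂 s B , λ y → ¬inj₂⇒IsInj₁ (h y) λ vertex-y → noVertex (y , vertex-y)
      ... | yes (x₀ , b₀ , hx₀) = vertex⇀𝕂 b₀ , inDom
        where
        inDom : ∀ y → Dom (vertex⇀𝕂 b₀) (h y)
        inDom y with h y in hy
        ... | inj₁ _ = tt
        ... | inj₂ b with clique-unrelated clique x₀ y (trans (cong₂ (R (plug⊎ s B)) hx₀ hy) (B-edgeless b₀ b))
        ...   | refl = inj₂-injective (trans (sym hy) hx₀)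

    module _ (ultrahomogeneous : Ultrahomogeneous) where

      disjointCopy : ∀ n n' → DisjointCopy n n'
      disjointCopy n n' = record
        { copy = embed ∘ inj₂
        ; copy-injective = inj₂-injective ∘ embed-injective
        ; copy-above = embed-above
        ; copy-U = embed-U ∘ inj₂
        ; copy-R = λ i i' → embed-R (inj₂ i) (inj₂ i')
        ; copy-unrelated = λ i r → trans (cong (RK _) (sym (embed-fixes r))) (embed-R (inj₂ i) (inj₁ r)) }
        where
        view = unsplit-splitView (amalgam⊎ n n')
        amalgam-inK = inK-splitView 𝓕-irreducible age view
          (amalgam⊎-isStructure K-isStr n n') (amalgam⊎-cliquesEmbed n n')
        open EmbeddingOver (embeddingOver age ultrahomogeneous view amalgam-inK (λ _ → refl) (λ _ _ → refl))

      inCT-if-point∈𝒦 : ∀ {N d} (t : Fin d → Node ku k N) j → 𝒦[ t ] (point j) → InCT N (t j)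
      inCT-if-point∈𝒦 {N} t j point∈𝒦 =
        embed (inj₂ zero) , embed-above zero , cong₂ _,_ (sym (embed-U (inj₂ zero))) codes
        where
        open EmbeddingOver
          (embeddingOver age ultrahomogeneous (plug-splitView t (point j)) point∈𝒦 (λ _ → refl) (λ _ _ → refl))
        codes : proj₂ (t j) ≡ tabulate (λ r → RK (embed (inj₂ zero)) (toℕ r))
        codes = sym (trans (tabulate-cong λ r → trans (cong (RK _) (sym (embed-fixes r))) (embed-R (inj₂ zero) (inj₁ r)))
                           (tabulate∘lookup _))

      module Restriction {d d₀ : ℕ} (ρ : Fin d → Fin ku) (e : Fin d₀ → Fin d) (e-injective : Injective _≡_ _≡_ e)
        {n n'} (s : Fin d → Node ku k n) (s' : Fin d₀ → Node ku k n')
        (s-U : ∀ j → proj₁ (s j) ≡ ρ j) (s'-U : ∀ j → proj₁ (s' j) ≡ ρ (e j)) where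

        open DisjointCopy (disjointCopy n n')

        opaque
          M : ℕ
          M = proj₁ (bound-above copy)

          copy<M : ∀ i → copy i ℕ.< M
          copy<M = proj₂ (bound-above copy)

        N : ℕ
        N = n + M

        copyAt : Fin n' → Fin N
        copyAt i = fromℕ< (ℕ.≤-trans (copy<M i) (ℕ.m≤n+m M n))

        toℕ-copyAt : ∀ i → toℕ (copyAt i) ≡ copy i
        toℕ-copyAt i = toℕ-fromℕ< _

        copyAt-injective : Injective _≡_ _≡_ copyAt
        copyAt-injective eq = copy-injective (trans (sym (toℕ-copyAt _)) (trans (cong toℕ eq) (toℕ-copyAt _)))

        low-below : ∀ r₀ → toℕ (r₀ ↑ˡ M) ℕ.< n
        low-below r₀ = subst (ℕ._< n) (sym (toℕ-↑ˡ r₀ M)) (toℕ<n r₀)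

        low≢copyAt : ∀ r₀ i → r₀ ↑ˡ M ≢ copyAt i
        low≢copyAt r₀ i eq =
          ℕ.<⇒≱ (low-below r₀) (subst (n ℕ.≤_) (trans (sym (toℕ-copyAt i)) (cong toℕ (sym eq))) (copy-above i))

        data Zone (r : Fin N) : Set where
          low : (r₀ : Fin n) → r ≡ r₀ ↑ˡ M → Zone r
          inCopy : (i : Fin n') → r ≡ copyAt i → Zone r
          high : n ℕ.≤ toℕ r → (∀ i → r ≢ copyAt i) → Zone r

        opaque
          zone : ∀ r → Zone r
          zone r = classify (toℕ r ℕ.<? n) (any? (λ i → r ≟ copyAt i))
            where
            classify : Dec (toℕ r ℕ.< n) → Dec (Σ (Fin n') λ i → r ≡ copyAt i) → Zone r
            classify (yes r<n) _ =
              low (fromℕ< r<n) (toℕ-injective (trans (sym (toℕ-fromℕ< r<n)) (sym (toℕ-↑ˡ _ M))))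
            classify (no _) (yes (i , r≡)) = inCopy i r≡
            classify (no r≮n) (no notCopy) = high (ℕ.≮⇒≥ r≮n) (λ i r≡ → notCopy (i , r≡))

        relToCopy : Fin d → Fin n' → Fin (suc k)
        relToCopy j i with any? (λ j' → e j' ≟ j)
        ... | yes (j' , _) = lookup (proj₂ (s' j')) i
        ... | no _ = zero

        relToCopy-e : ∀ j' i → relToCopy (e j') i ≡ lookup (proj₂ (s' j')) i
        relToCopy-e j' i with any? (λ j'' → e j'' ≟ e j')
        ... | yes (j'' , ej''≡ej') = cong (λ j → lookup (proj₂ (s' j)) i) (e-injective ej''≡ej')
        ... | no ∉ = ⊥-elim (∉ (j' , refl))

        relToCopy-∉ : ∀ j i → (∀ j' → e j' ≢ j) → relToCopy j i ≡ zero
        relToCopy-∉ j i ∉ with any? (λ j' → e j' ≟ j)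
        ... | yes (j' , ej'≡j) = ⊥-elim (∉ j' ej'≡j)
        ... | no _ = refl

        codeAt : ∀ j {r} → Zone r → Fin (suc k)
        codeAt j (low r₀ _) = lookup (proj₂ (s j)) r₀
        codeAt j (inCopy i _) = relToCopy j i
        codeAt j (high _ _) = zero

        codeAt-unique : ∀ j {r} (z z' : Zone r) → codeAt j z ≡ codeAt j z'
        codeAt-unique j (low r₀ refl) (low r₁ eq) = cong (lookup (proj₂ (s j))) (↑ˡ-injective M r₀ r₁ eq)
        codeAt-unique j (inCopy i refl) (inCopy i' eq) = cong (relToCopy j) (copyAt-injective eq)
        codeAt-unique j (high _ _) (high _ _) = refl
        codeAt-unique j (low r₀ refl) (inCopy i eq) = ⊥-elim (low≢copyAt r₀ i eq)
        codeAt-unique j (inCopy i refl) (low r₀ eq) = ⊥-elim (low≢copyAt r₀ i (sym eq))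
        codeAt-unique j (low r₀ refl) (high n≤ _) = ⊥-elim (ℕ.<⇒≱ (low-below r₀) n≤)
        codeAt-unique j (high n≤ _) (low r₀ refl) = ⊥-elim (ℕ.<⇒≱ (low-below r₀) n≤)
        codeAt-unique j (inCopy i refl) (high _ notCopy) = ⊥-elim (notCopy i refl)
        codeAt-unique j (high _ notCopy) (inCopy i eq) = ⊥-elim (notCopy i eq)

        t : Fin d → Node ku k N
        t j = ρ j , tabulate (λ r → codeAt j (zone r))

        t-lookup : ∀ j {r} (z : Zone r) → lookup (proj₂ (t j)) r ≡ codeAt j z
        t-lookup j {r} z = trans (lookup∘tabulate _ r) (codeAt-unique j (zone r) z)

        module _ (B : LdStr k d) (B-isLdStr : IsLdStr B) where
          private
            open LdRaw (proj₂ B) using (V)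
            Bᵉ = restrictV e B

          ι : plug⊎ s B ⟶ plug⊎ t B
          ι .to (inj₁ r₀) = inj₁ (r₀ ↑ˡ M)
          ι .to (inj₂ b) = inj₂ b
          ι .to-U (inj₁ r₀) = cong UK (toℕ-↑ˡ r₀ M)
          ι .to-U (inj₂ b) = sym (s-U (V b))
          ι .to-R (inj₁ r₀) (inj₁ r₁) = cong₂ RK (toℕ-↑ˡ r₀ M) (toℕ-↑ˡ r₁ M)
          ι .to-R (inj₂ b) (inj₂ b') = refl
          ι .to-R (inj₂ b) (inj₁ r₀) = t-lookup (V b) (low r₀ refl)
          ι .to-R (inj₁ r₀) (inj₂ b) = cong Flip (t-lookup (V b) (low r₀ refl))
          ι .to-injective (inj₁ r₀) (inj₁ r₁) eq = inj₁ (cong inj₁ (↑ˡ-injective M r₀ r₁ (inj₁-injective eq)))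
          ι .to-injective (inj₂ b) (inj₂ b') eq = inj₁ (cong inj₂ (inj₂-injective eq))
          ι .to-injective (inj₁ _) (inj₂ _) ()
          ι .to-injective (inj₂ _) (inj₁ _) ()

          t-lookup-copyAt : ∀ x i → lookup (proj₂ (t (V (underlying e B x)))) (copyAt i)
                                  ≡ lookup (proj₂ (s' (LdRaw.V (proj₂ Bᵉ) x))) i
          t-lookup-copyAt x i = trans (t-lookup _ (inCopy i refl))
            (trans (cong (λ j → relToCopy j i) (sym (restrictV-colour e B x))) (relToCopy-e _ i))

          ι' : plug⊎ s' Bᵉ ⟶ plug⊎ t B
          ι' .to (inj₁ i) = inj₁ (copyAt i)
          ι' .to (inj₂ x) = inj₂ (underlying e B x)
          ι' .to-U (inj₁ i) = trans (cong UK (toℕ-copyAt i)) (copy-U i)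
          ι' .to-U (inj₂ x) = trans (cong ρ (sym (restrictV-colour e B x))) (sym (s'-U _))
          ι' .to-R (inj₁ i) (inj₁ i') = trans (cong₂ RK (toℕ-copyAt i) (toℕ-copyAt i')) (copy-R i i')
          ι' .to-R (inj₂ x) (inj₂ y) = refl
          ι' .to-R (inj₂ x) (inj₁ i) = t-lookup-copyAt x i
          ι' .to-R (inj₁ i) (inj₂ x) = cong Flip (t-lookup-copyAt x i)
          ι' .to-injective (inj₁ i) (inj₁ i') eq = inj₁ (cong inj₁ (copyAt-injective (inj₁-injective eq)))
          ι' .to-injective (inj₂ x) (inj₂ y) eq =
            inj₂ (trans (cong (LdRaw.R (proj₂ B) _) (sym (inj₂-injective eq))) (proj₁ B-isLdStr _))
          ι' .to-injective (inj₁ _) (inj₂ _) ()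
          ι' .to-injective (inj₂ _) (inj₁ _) ()

          module _ {p} {h : Fin p → Fin N ⊎ Fin (proj₁ B)} (clique : IsClique (plug⊎ t B) h)
                   {x₀ b₀} (hx₀ : h x₀ ≡ inj₂ b₀) where

            clique-avoids-high : ∀ y {r} → h y ≡ inj₁ r → n ℕ.≤ toℕ r → (∀ i → r ≢ copyAt i) → ⊥
            clique-avoids-high y hy n≤r notCopy
              with clique-unrelated clique x₀ y
                     (trans (cong₂ (R (plug⊎ t B)) hx₀ hy) (t-lookup (V b₀) (high n≤r notCopy)))
            ... | refl = inj₂≢inj₁ (trans (sym hx₀) hy)

            clique-inside-ι : (∀ y i → h y ≢ inj₁ (copyAt i)) → ∀ y → Dom (inverse ι) (h y)
            clique-inside-ι noCopy y = inside (h y) refl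
              where
              inside : ∀ z → h y ≡ z → Dom (inverse ι) z
              inside (inj₂ b) _ = inj₂ b , refl
              inside (inj₁ r) hy = byZone (zone r)
                where
                byZone : Zone r → Dom (inverse ι) (inj₁ r)
                byZone (low r₀ r≡) = inj₁ r₀ , cong inj₁ (sym r≡)
                byZone (inCopy i r≡) = ⊥-elim (noCopy y i (trans hy (cong inj₁ r≡)))
                byZone (high n≤r notCopy) = ⊥-elim (clique-avoids-high y hy n≤r notCopy)

            module _ {y₀ i₀} (hy₀ : h y₀ ≡ inj₁ (copyAt i₀)) where

              copy-unrelated-low : ∀ y r₀ → h y ≢ inj₁ (r₀ ↑ˡ M)
              copy-unrelated-low y r₀ hy with clique-unrelated clique y₀ y (trans (cong₂ (R (plug⊎ t B)) hy₀ hy)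
                (trans (cong₂ RK (toℕ-copyAt i₀) (toℕ-↑ˡ r₀ M)) (copy-unrelated i₀ r₀)))
              ... | refl = low≢copyAt r₀ i₀ (inj₁-injective (trans (sym hy) hy₀))

              copy-unrelated-∉ : ∀ y b → h y ≡ inj₂ b → (∀ j → e j ≢ V b) → ⊥
              copy-unrelated-∉ y b hy ∉ with clique-unrelated clique y₀ y (trans (cong₂ (R (plug⊎ t B)) hy₀ hy)
                (trans (cong Flip (trans (t-lookup (V b) (inCopy i₀ refl)) (relToCopy-∉ (V b) i₀ ∉))) Flip-zero))
              ... | refl = inj₂≢inj₁ (trans (sym hy) hy₀)

              clique-inside-ι' : ∀ y → Dom (inverse ι') (h y)
              clique-inside-ι' y = inside (h y) refl
                where
                inside : ∀ z → h y ≡ z → Dom (inverse ι') z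
                inside (inj₂ b) hy = byColour (any? (λ j → e j ≟ V b))
                  where
                  byColour : Dec (Σ (Fin d₀) λ j → e j ≡ V b) → Dom (inverse ι') (inj₂ b)
                  byColour (yes (j , ej≡Vb)) = inj₂ (proj₁ onto) , cong inj₂ (proj₂ onto)
                    where
                    onto = restrictV-onto e B b j ej≡Vb
                  byColour (no ∉) = ⊥-elim (copy-unrelated-∉ y b hy λ j ej≡Vb → ∉ (j , ej≡Vb))
                inside (inj₁ r) hy = byZone (zone r)
                  where
                  byZone : Zone r → Dom (inverse ι') (inj₁ r)
                  byZone (low r₀ r≡) = ⊥-elim (copy-unrelated-low y r₀ (trans hy (cong inj₁ r≡)))
                  byZone (inCopy i r≡) = inj₁ i , cong inj₁ (sym r≡)
                  byZone (high n≤r notCopy) = ⊥-elim (clique-avoids-high y hy n≤r notCopy)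

          -- In B[t] the high zone is unrelated to B, and the copy is unrelated to 𝐊_n and to the vertices
          -- whose colour is not in the image of e; so a clique meeting B lies in the image of ι or of ι'.
          cliquesEmbed-t : 𝒦[ s ] B → 𝒦[ s' ] Bᵉ → CliquesEmbed (plug⊎ t B)
          cliquesEmbed-t B∈ Bᵉ∈ {p} h clique = byVertex (any? (λ x → inj₂? (h x)))
            where
            byVertex : Dec (Σ (Fin p) λ x → Σ _ λ b → h x ≡ inj₂ b) → Covered (plug⊎ t B) h
            byVertex (no noVertex) = base⇀𝕂 t B , λ y → ¬inj₂⇒IsInj₁ (h y) λ vertex-y → noVertex (y , vertex-y)
            byVertex (yes (x₀ , b₀ , hx₀)) = byCopy (any? λ y → any? λ i → ≡-dec _≟_ _≟_ (h y) (inj₁ (copyAt i)))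
              where
              byCopy : Dec (Σ (Fin p) λ y → Σ (Fin n') λ i → h y ≡ inj₁ (copyAt i)) → Covered (plug⊎ t B) h
              byCopy (yes (y₀ , i₀ , hy₀)) =
                partial (splitView-⟶𝕂 𝓕-irreducible age (plug-splitView s' Bᵉ) Bᵉ∈) ∘ₚ inverse ι' ,
                λ y → clique-inside-ι' clique hx₀ hy₀ y , tt
              byCopy (no noCopy) =
                partial (splitView-⟶𝕂 𝓕-irreducible age (plug-splitView s B) B∈) ∘ₚ inverse ι ,
                λ y → clique-inside-ι clique hx₀ (λ y i hy → noCopy (y , i , hy)) y , tt

          ∈𝒦[t] : 𝒦[ s ] B → 𝒦[ s' ] Bᵉ → 𝒦[ t ] B
          ∈𝒦[t] B∈ Bᵉ∈ = inK-splitView 𝓕-irreducible age (plug-splitView t B)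
            (plug⊎-isStructure t B K-isStr B-isLdStr) (cliquesEmbed-t B∈ Bᵉ∈)

          ∈𝒦[t]⇒∈𝒦[s] : 𝒦[ t ] B → 𝒦[ s ] B
          ∈𝒦[t]⇒∈𝒦[s] B∈ = inK-splitView 𝓕-irreducible age (plug-splitView s B)
            (plug⊎-isStructure s B K-isStr B-isLdStr)
            (cliquesEmbed-⟶𝕂 (splitView-⟶𝕂 𝓕-irreducible age (plug-splitView t B) B∈ ∘ₜ ι))

          ∈𝒦[t]⇒∈𝒦[s'] : 𝒦[ t ] B → 𝒦[ s' ] Bᵉ
          ∈𝒦[t]⇒∈𝒦[s'] B∈ = inK-splitView 𝓕-irreducible age (plug-splitView s' Bᵉ)
            (plug⊎-isStructure s' Bᵉ K-isStr (restrictV-isLdStr e B-isLdStr))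
            (cliquesEmbed-⟶𝕂 (splitView-⟶𝕂 𝓕-irreducible age (plug-splitView t B) B∈ ∘ₜ ι'))

        𝒦[t]≐ : (𝒦[ s ] ∣[ e , 𝒦[ s' ] ]) ≐ 𝒦[ t ]
        𝒦[t]≐ B = (λ (B∈ , Bᵉ∈) → ∈𝒦[t] B (isLdStr-if-plug s B (proj₁ B∈)) B∈ Bᵉ∈) ,
                  (λ B∈ → let B-isLdStr = isLdStr-if-plug t B (proj₁ B∈)
                          in ∈𝒦[t]⇒∈𝒦[s] B B-isLdStr B∈ , ∈𝒦[t]⇒∈𝒦[s'] B B-isLdStr B∈)

        t-ordered : (∀ i j → i < j → s i ≺lex s j) → ∀ i j → i < j → t i ≺lex t j
        t-ordered s-ordered i j i<j with s-ordered i j i<j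
        ... | inj₁ u< = inj₁ (subst₂ Fin._<_ (s-U i) (s-U j) u<)
        ... | inj₂ (u≡ , v<) = inj₂ (trans (sym (s-U i)) (trans u≡ (s-U j)) ,
                                     <lexV-extend v< (λ r → t-lookup i (low r refl)) (λ r → t-lookup j (low r refl)))

        t-inCT : (∀ j → InCT n (s j)) → (∀ j → InCT n' (s' j)) → ∀ j → InCT N (t j)
        t-inCT s-CT s'-CT j = inCT-if-point∈𝒦 t j
          (∈𝒦[t] (point j) (edgeless-isLdStr {B = point j} λ _ _ → refl)
            (edgeless∈𝒦 s s-CT λ _ _ → refl) (edgeless∈𝒦 s' s'-CT λ _ _ → refl))

        restriction∈P : ∀ {𝒜 ℬ} → (∀ i j → i < j → s i ≺lex s j) → (∀ j → InCT n (s j)) → (∀ j → InCT n' (s' j)) →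
          𝒜 ≐ 𝒦[ s ] → ℬ ≐ 𝒦[ s' ] → P ρ (𝒜 ∣[ e , ℬ ])
        restriction∈P s-ordered s-CT s'-CT 𝒜≐ ℬ≐ =
          N , t , t-ordered s-ordered , t-inCT s-CT s'-CT , (λ _ → refl) , ≐-trans (∣-cong e 𝒜≐ ℬ≐) 𝒦[t]≐

proposition4p16 : (ku k : ℕ) (Flip : Fin (suc k) → Fin (suc k)) →
    (∀ i → Flip (Flip i) ≡ i) → Flip zero ≡ zero →
    (𝓕 : List (Σ ℕ (RawStr ku k))) (𝐊 : InfStr ku k) →
    let open Setting ku k Flip 𝓕 𝐊 in
    All (λ F → IsStr (proj₂ F) × IsIrreducible (proj₂ F)) 𝓕 →
    NonDegenerate →
    IsFraisseLimit → LeftDense →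
    (d : ℕ) (ρ : Fin d → Fin ku) → (∀ i j → i ≤ j → ρ i ≤ ρ j) →
    (d₀ : ℕ) (e : Fin d₀ → Fin d) → (∀ i j → i < j → e i < e j) →
    (𝒜 : LdClass k d) (ℬ : LdClass k d₀) →
    P ρ 𝒜 → P (ρ ∘ e) ℬ →
    P ρ (𝒜 ∣[ e , ℬ ])
proposition4p16 ku k Flip Flip-involutive Flip-zero 𝓕 𝐊 𝓕-irreducible _ (K-isStr , age , ultrahomogeneous) _
  d ρ _ d₀ e e-increasing 𝒜 ℬ (n , s , s-ordered , s-CT , s-U , 𝒜≐) (n' , s' , _ , s'-CT , s'-U , ℬ≐) =
  Restriction.restriction∈P ku k Flip Flip-involutive Flip-zero 𝓕 𝐊 K-isStr 𝓕-irreducible age ultrahomogeneous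
    ρ e (increasing⇒injective e-increasing) s s' s-U s'-U s-ordered s-CT s'-CT 𝒜≐ ℬ≐
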